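{- Let $\mathcal{G}$ be a snake graph and $\mathcal{T}_\mathcal{G}$ its triangular snake graph. Then $\mathcal{T}_\mathcal{G}$ has the same number of sources as sinks.
   Context: A tile is a 4-cycle drawn as a unit square in the plane with vertices at integer points, with north, south, east and west edges. A snake graph $\mathcal{G}$ with $d\ge1$ tiles is formed by a sequence of unit squares $G_1,\dots,G_d$ in $\mathbb{Z}^2$ such that for each $i<d$, $G_{i+1}$ is either immediately above $G_i$ (north edge of $G_i$ = south edge of $G_{i+1}$) or immediately to the right of $G_i$ (east edge of $G_i$ = west edge of $G_{i+1}$); vertices and edges are the unions of those of the tiles. Triangular snake graph: for odd $i$ let $c_i$ be the north edge of $G_i$, for even $i$ let $c_i$ be the south edge of $G_i$ (possibly $c_i=c_{i+1}$). $\mathcal{T}_\mathcal{G}$ is the directed graph obtained from $\mathcal{G}$ by contracting each edge $c_i$ to a single vertex $\mathbf{c}_i$ (a "contracted vertex") and orienting the remaining edges as follows: for odd $i$, if $a,b$ are the south-west and south-east corners of $G_i$, orient the south edge $a\to b$, the west edge $a\to\mathbf{c}_i$, the east edge $\mathbf{c}_i\to b$; for even $i$, if $a,b$ are the north-west and north-east corners of $G_i$, orient the north edge $a\to b$, the west edge $a\to \mathbf{c}_i$, the east edge $\mathbf{c}_i\to b$. A source is a vertex with no incoming arrow; a sink is a vertex with no outgoing arrow. -}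

module Defs where

open import Data.Nat using (ℕ; zero; suc)
open import Data.Bool using (Bool; true; false; not)
open import Data.Fin using (Fin; toℕ)
open import Data.List using (List; []; _∷_; length)
open import Data.List.Relation.Unary.All using (All)
open import Data.List.Relation.Unary.Any using (Any)
open import Data.List.Relation.Unary.AllPairs using (AllPairs)
open import Data.Product using (_×_; _,_; ∃; ∃-syntax)
open import Relation.Binary.PropositionalEquality using (_≡_)
open import Relation.Nullary using (¬_)
open import Relation.Binary.Construct.Closure.Equivalence using (EqClosure)

-- Points of ℤ² reachable by a snake starting at the origin (only north/east moves).
Point : Set
Point = ℕ × ℕ

data Dir : Set where
  N E : Dir

-- A snake graph with d = suc (length ds) tiles G_0 … G_{d-1} (0-indexed),
-- where ds lists the successive directions; G_0 has south-west corner (0,0).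
Snake : Set
Snake = List Dir

NumTiles : Snake → ℕ
NumTiles ds = suc (length ds)

Tile : Snake → Set
Tile ds = Fin (NumTiles ds)

shift : Dir → Point → Point
shift N (x , y) = (x , suc y)
shift E (x , y) = (suc x , y)

swCorner : Snake → ℕ → Point
swCorner ds zero = (0 , 0)
swCorner [] (suc k) = (0 , 0)
swCorner (d ∷ ds) (suc k) = shift d (swCorner ds k)

pos : (ds : Snake) → Tile ds → Point
pos ds k = swCorner ds (toℕ k)

-- 0-indexed tile k is paper's tile i = k+1; paper-odd i ⇔ k even.
evenᵇ : ℕ → Bool
evenᵇ zero = true
evenᵇ (suc n) = not (evenᵇ n)

paperOdd : {ds : Snake} → Tile ds → Bool
paperOdd k = evenᵇ (toℕ k)

data Corner : Point → Point → Set where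
  sw : ∀ {x y} → Corner (x , y) (x , y)
  se : ∀ {x y} → Corner (x , y) (suc x , y)
  nw : ∀ {x y} → Corner (x , y) (x , suc y)
  ne : ∀ {x y} → Corner (x , y) (suc x , suc y)

IsVertex : Snake → Point → Set
IsVertex ds p = ∃[ k ] Corner (pos ds k) p

data CEdgeOf : Bool → Point → Point → Point → Set where
  cNorth : ∀ {x y} → CEdgeOf true  (x , y) (x , suc y) (suc x , suc y)
  cSouth : ∀ {x y} → CEdgeOf false (x , y) (x , y) (suc x , y)

CEdge : Snake → Point → Point → Set
CEdge ds p q = ∃[ k ] CEdgeOf (paperOdd {ds} k) (pos ds k) p q

-- Contracting all edges c_i: two vertices of 𝒢 become the same vertex of 𝒯_𝒢
-- iff they are related by the equivalence closure of "endpoints of some c_i".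
_∼⟨_⟩_ : Point → Snake → Point → Set
p ∼⟨ ds ⟩ q = EqClosure (CEdge ds) p q

-- The oriented (non-contracted) edges of a tile, as arrows between points of 𝒢
-- (an endpoint lying on c_i stands for the contracted vertex 𝐜_i).
data TileArrow : Bool → Point → Point → Point → Set where
  -- paper-odd tile: a = SW, b = SE, c_i = north edge
  oddS : ∀ {x y} → TileArrow true (x , y) (x , y) (suc x , y)
  oddW : ∀ {x y} → TileArrow true (x , y) (x , y) (x , suc y)
  oddE : ∀ {x y} → TileArrow true (x , y) (suc x , suc y) (suc x , y)
  -- paper-even tile: a = NW, b = NE, c_i = south edge
  evenN : ∀ {x y} → TileArrow false (x , y) (x , suc y) (suc x , suc y)
  evenW : ∀ {x y} → TileArrow false (x , y) (x , suc y) (x , y)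
  evenE : ∀ {x y} → TileArrow false (x , y) (suc x , y) (suc x , suc y)

Arrow : Snake → Point → Point → Set
Arrow ds u v = ∃[ k ] TileArrow (paperOdd {ds} k) (pos ds k) u v

IsSource : Snake → Point → Set
IsSource ds p = IsVertex ds p × (∀ u v → Arrow ds u v → ¬ (v ∼⟨ ds ⟩ p))

IsSink : Snake → Point → Set
IsSink ds p = IsVertex ds p × (∀ u v → Arrow ds u v → ¬ (u ∼⟨ ds ⟩ p))

-- The number of vertices of 𝒯_𝒢 (classes of ∼) satisfying P is n:
-- a list of n representatives satisfying P, pairwise in distinct classes,
-- and meeting every class whose representatives satisfy P.
NumClasses : (ds : Snake) → (Point → Set) → ℕ → Set
NumClasses ds P n =
  ∃[ L ] (length L ≡ n
         × All P L
         × AllPairs (λ p q → ¬ (p ∼⟨ ds ⟩ q)) L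
         × (∀ p → P p → Any (λ q → p ∼⟨ ds ⟩ q) L))

-- A point p represents a source of 𝒯_𝒢 exactly when p is the corner a of every tile containing it;
-- such a p is an endpoint of no contracted edge c_i, so its class is {p}. Dually for sinks and b.
-- As the k-th tile is the only tile on the anti-diagonal x + y = k, a local case analysis shows that
-- the sources other than (0,0) are the points P + (0,2), and the sinks other than the b-corner of
-- the last tile are the points P + (1,0), where P runs over the south-west corners of the tiles G_i
-- with i odd whose successor lies above them. So both numbers are one more than the number of
-- such tiles.

module Submission where

open import Defs
open import Data.Bool using (Bool; true; false; not)
open import Data.Bool.Properties using (not-involutive) renaming (_≟_ to _≟ᵇ_)
open import Data.Empty using (⊥-elim)
open import Data.Fin using (toℕ; fromℕ<)
open import Data.Fin.Properties using (toℕ-injective; toℕ-fromℕ<; toℕ≤pred[n])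
open import Data.List using (List; _∷_; length; map; filter; allFin)
open import Data.List.Properties using (length-map)
open import Data.List.Membership.Propositional using (_∈_)
open import Data.List.Membership.Propositional.Properties using (∈-map⁺; ∈-map⁻; ∈-filter⁺; ∈-allFin)
open import Data.List.Relation.Unary.All as All using (All; []; _∷_)
open import Data.List.Relation.Unary.All.Properties using (all-filter) renaming (map⁺ to All-map⁺)
open import Data.List.Relation.Unary.Any as Any using (here; there)
open import Data.List.Relation.Unary.AllPairs using (AllPairs; []; _∷_)
open import Data.List.Relation.Unary.Unique.Propositional using (Unique)
import Data.List.Relation.Unary.Unique.Propositional.Properties as Unique
open import Data.Nat using (ℕ; zero; suc; _+_; _≤_; _<_; z≤n; s≤s)
open import Data.Nat.Properties
  using (+-suc; _≟_; ≤-refl; ≤-reflexive; <⇒≤; <⇒≱; m≤n⇒m<n∨m≡n; m≤n⇒m≤1+n; n≤1+n; +-monoʳ-≤; 1+n≢n)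
open import Data.Product using (_×_; _,_; ∃; ∃₂; ∃-syntax; proj₁; proj₂)
open import Data.Product.Properties using (≡-dec)
open import Data.Sum using (_⊎_; inj₁; inj₂)
open import Function using (_∘_)
open import Relation.Binary using (Rel)
open import Relation.Binary.PropositionalEquality using (_≡_; _≢_; refl; sym; trans; cong; subst; subst₂)
open import Relation.Binary.Construct.Closure.ReflexiveTransitive using (ε; _◅_)
open import Relation.Binary.Construct.Closure.Symmetric using (fwd; bwd)
open import Relation.Binary.Construct.Closure.Equivalence using (EqClosure; symmetric)
open import Relation.Nullary using (Dec; yes; no; ¬_)
open import Relation.Nullary.Decidable using (_×-dec_; map′)

EqClosure-isolated : ∀ {a ℓ} {A : Set a} {R : Rel A ℓ} {p q : A} →
                     (∀ {u v} → R u v → u ≢ p × v ≢ p) → EqClosure R p q → p ≡ q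
EqClosure-isolated avoids ε           = refl
EqClosure-isolated avoids (fwd r ◅ _) = ⊥-elim (proj₁ (avoids r) refl)
EqClosure-isolated avoids (bwd r ◅ _) = ⊥-elim (proj₂ (avoids r) refl)

_≟P_ : (P Q : Point) → Dec (P ≡ Q)
_≟P_ = ≡-dec _≟_ _≟_

sumPt : Point → ℕ
sumPt (x , y) = x + y

sumPt-shift : ∀ d P → sumPt (shift d P) ≡ suc (sumPt P)
sumPt-shift N (x , y) = +-suc x y
sumPt-shift E (x , y) = refl

shift-comm : ∀ d e P → shift d (shift e P) ≡ shift e (shift d P)
shift-comm N N P = refl
shift-comm N E P = refl
shift-comm E N P = refl
shift-comm E E P = refl

shift-injective : ∀ d {P Q} → shift d P ≡ shift d Q → P ≡ Q
shift-injective N refl = refl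
shift-injective E refl = refl

north≢east : ∀ P → shift N P ≢ shift E P
north≢east P eq = 1+n≢n (sym (cong proj₁ eq))

northeast≢ : ∀ P → shift N (shift E P) ≢ P
northeast≢ P eq = 1+n≢n (cong proj₁ eq)

-- The k-th tile (0-indexed) lies on the anti-diagonal x + y = k, so paperOdd of a tile is the
-- parity of its south-west corner.
parity : Point → Bool
parity P = evenᵇ (sumPt P)

parity-shift : ∀ d P → parity (shift d P) ≡ not (parity P)
parity-shift d P = cong evenᵇ (sumPt-shift d P)

parity-pred : ∀ d P {b} → parity (shift d P) ≡ b → parity P ≡ not b
parity-pred d P refl = trans (sym (not-involutive (parity P))) (cong not (sym (parity-shift d P)))

parity-shift² : ∀ d e P → parity (shift d (shift e P)) ≡ parity P
parity-shift² d e P = trans (parity-shift d _) (trans (cong not (parity-shift e P)) (not-involutive _))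

odd≢origin : ∀ {Q} → parity Q ≡ false → Q ≢ (0 , 0)
odd≢origin odd refl with odd
... | ()

aCorner : Bool → Point → Point
aCorner true  (x , y) = (x , y)
aCorner false (x , y) = (x , suc y)

bCorner : Bool → Point → Point
bCorner true  (x , y) = (suc x , y)
bCorner false (x , y) = (suc x , suc y)

bCorner-corner : ∀ b P → Corner P (bCorner b P)
bCorner-corner true  P = se
bCorner-corner false P = ne

sumPt-bCorner : ∀ b P → sumPt P < sumPt (bCorner b P)
sumPt-bCorner true  (x , y) = ≤-refl
sumPt-bCorner false (x , y) = s≤s (+-monoʳ-≤ x (n≤1+n y))

corner-isA-or-entered : ∀ b {P q} → Corner P q →
  q ≡ aCorner b P ⊎ ∃₂ λ u v → TileArrow b P u v × (v ≡ q ⊎ CEdgeOf b P v q)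
corner-isA-or-entered true  sw = inj₁ refl
corner-isA-or-entered true  se = inj₂ (_ , _ , oddS , inj₁ refl)
corner-isA-or-entered true  nw = inj₂ (_ , _ , oddW , inj₁ refl)
corner-isA-or-entered true  ne = inj₂ (_ , _ , oddW , inj₂ cNorth)
corner-isA-or-entered false sw = inj₂ (_ , _ , evenW , inj₁ refl)
corner-isA-or-entered false se = inj₂ (_ , _ , evenW , inj₂ cSouth)
corner-isA-or-entered false nw = inj₁ refl
corner-isA-or-entered false ne = inj₂ (_ , _ , evenN , inj₁ refl)

corner-isB-or-exited : ∀ b {P q} → Corner P q →
  q ≡ bCorner b P ⊎ ∃₂ λ u v → TileArrow b P u v × (u ≡ q ⊎ CEdgeOf b P q u)
corner-isB-or-exited true  sw = inj₂ (_ , _ , oddS , inj₁ refl)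
corner-isB-or-exited true  se = inj₁ refl
corner-isB-or-exited true  nw = inj₂ (_ , _ , oddE , inj₂ cNorth)
corner-isB-or-exited true  ne = inj₂ (_ , _ , oddE , inj₁ refl)
corner-isB-or-exited false sw = inj₂ (_ , _ , evenE , inj₂ cSouth)
corner-isB-or-exited false se = inj₂ (_ , _ , evenE , inj₁ refl)
corner-isB-or-exited false nw = inj₂ (_ , _ , evenN , inj₁ refl)
corner-isB-or-exited false ne = inj₁ refl

arrow-tail : ∀ {b P u v} → TileArrow b P u v → Corner P u × u ≢ bCorner b P
arrow-tail oddS  = sw , λ ()
arrow-tail oddW  = sw , λ ()
arrow-tail oddE  = ne , λ ()
arrow-tail evenN = nw , λ ()
arrow-tail evenW = nw , λ ()
arrow-tail evenE = se , λ ()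

arrow-head : ∀ {b P u v} → TileArrow b P u v → Corner P v × v ≢ aCorner b P
arrow-head oddS  = se , λ ()
arrow-head oddW  = nw , λ ()
arrow-head oddE  = se , λ ()
arrow-head evenN = ne , λ ()
arrow-head evenW = sw , λ ()
arrow-head evenE = ne , λ ()

InnerCorner : Bool → Point → Point → Set
InnerCorner b P q = Corner P q × q ≢ aCorner b P × q ≢ bCorner b P

cEdge-inner : ∀ {b P v w} → CEdgeOf b P v w → InnerCorner b P v × InnerCorner b P w
cEdge-inner cNorth = (nw , (λ ()) , (λ ())) , (ne , (λ ()) , (λ ()))
cEdge-inner cSouth = (sw , (λ ()) , (λ ())) , (se , (λ ()) , (λ ()))

sumPt-swCorner : ∀ ds k → k ≤ length ds → sumPt (swCorner ds k) ≡ k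
sumPt-swCorner ds       zero    _       = refl
sumPt-swCorner (d ∷ ds) (suc k) (s≤s k≤) = trans (sumPt-shift d _) (cong suc (sumPt-swCorner ds k k≤))

swCorner-suc : ∀ ds k → suc k ≤ length ds →
               ∃ λ d → swCorner ds (suc k) ≡ shift d (swCorner ds k)
swCorner-suc (d ∷ ds) zero    _       = d , refl
swCorner-suc (d ∷ ds) (suc k) (s≤s k<) with swCorner-suc ds k k<
... | e , eq = e , trans (cong (shift d) eq) (shift-comm d e _)

module _ (ds : Snake) where
  private
    L = length ds

  IsTile : Point → Set
  IsTile P = ∃ λ k → k ≤ L × swCorner ds k ≡ P

  last : Point
  last = swCorner ds L

  lastSink : Point
  lastSink = bCorner (parity last) last

  last-isTile : IsTile last
  last-isTile = L , ≤-refl , refl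

  sumPt-last : sumPt last ≡ L
  sumPt-last = sumPt-swCorner ds L ≤-refl

  tile-sum≤ : ∀ {P} → IsTile P → sumPt P ≤ L
  tile-sum≤ (k , k≤ , refl) = subst (_≤ L) (sym (sumPt-swCorner ds k k≤)) k≤

  tile-unique : ∀ {P Q} → IsTile P → IsTile Q → sumPt P ≡ sumPt Q → P ≡ Q
  tile-unique (j , j≤ , refl) (k , k≤ , refl) eq =
    cong (swCorner ds) (trans (sym (sumPt-swCorner ds j j≤)) (trans eq (sumPt-swCorner ds k k≤)))

  shift-beyond-last : ∀ {d P} → L ≤ sumPt P → ¬ IsTile (shift d P)
  shift-beyond-last {d} {P} L≤ tQ =
    <⇒≱ (subst (L <_) (sym (sumPt-shift d P)) (s≤s L≤)) (tile-sum≤ tQ)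

  predecessor : ∀ {Q} → IsTile Q → Q ≢ (0 , 0) → ∃₂ λ d P → IsTile P × Q ≡ shift d P
  predecessor (zero  , _  , refl) Q≢0 = ⊥-elim (Q≢0 refl)
  predecessor (suc k , k< , refl) _ with swCorner-suc ds k k<
  ... | d , eq = d , _ , (k , <⇒≤ k< , refl) , eq

  successor : ∀ {P} → IsTile P → P ≢ last → ∃ λ d → IsTile (shift d P)
  successor (k , k≤ , refl) P≢last with m≤n⇒m<n∨m≡n k≤
  ... | inj₂ refl = ⊥-elim (P≢last refl)
  ... | inj₁ k< with swCorner-suc ds k k<
  ...   | d , eq = d , suc k , k< , eq

  pos-isTile : (J : Tile ds) → IsTile (pos ds J)
  pos-isTile J = toℕ J , toℕ≤pred[n] J , refl

  tileIndex : ∀ {P} → IsTile P → ∃ λ (J : Tile ds) → pos ds J ≡ P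
  tileIndex (k , k≤ , refl) = fromℕ< (s≤s k≤) , cong (swCorner ds) (toℕ-fromℕ< (s≤s k≤))

  sumPt-pos : (J : Tile ds) → sumPt (pos ds J) ≡ toℕ J
  sumPt-pos J = sumPt-swCorner ds (toℕ J) (toℕ≤pred[n] J)

  pos-injective : ∀ {J K} → pos ds J ≡ pos ds K → J ≡ K
  pos-injective {J} {K} eq = toℕ-injective (trans (sym (sumPt-pos J)) (trans (cong sumPt eq) (sumPt-pos K)))

  paperOdd-parity : (J : Tile ds) → paperOdd {ds} J ≡ parity (pos ds J)
  paperOdd-parity J = cong evenᵇ (sym (sumPt-pos J))

  module _ (F : Bool → Point → Set) where
    atTile : (∃ λ J → F (paperOdd {ds} J) (pos ds J)) → ∃ λ P → IsTile P × F (parity P) P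
    atTile (J , x) = pos ds J , pos-isTile J , subst (λ b → F b (pos ds J)) (paperOdd-parity J) x

    atIndex : ∀ {P} → IsTile P → F (parity P) P → ∃ λ J → F (paperOdd {ds} J) (pos ds J)
    atIndex tP x with tileIndex tP
    ... | J , refl = J , subst (λ b → F b (pos ds J)) (sym (paperOdd-parity J)) x

  Isolated : Point → Set
  Isolated p = ∀ {q} → p ∼⟨ ds ⟩ q → p ≡ q

  numClasses : ∀ {X : Point → Set} {ps} → (∀ {p} → X p → Isolated p) → All X ps → Unique ps →
               (∀ {p} → X p → p ∈ ps) → NumClasses ds X (length ps)
  numClasses {X} {ps} isolated all unique complete =
    ps , refl , all , separated all unique , λ p Xp → Any.map (λ { refl → ε }) (complete Xp)
    where
    separated : ∀ {qs} → All X qs → Unique qs → AllPairs (λ p q → ¬ p ∼⟨ ds ⟩ q) qs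
    separated []        []       = []
    separated (Xp ∷ Xs) (p∉ ∷ u) =
      All.map (λ p≢q p∼q → p≢q (isolated Xp p∼q)) p∉ ∷ separated Xs u

  LocalSource : Point → Set
  LocalSource p = ∀ {P} → IsTile P → Corner P p → p ≡ aCorner (parity P) P

  LocalSink : Point → Set
  LocalSink p = ∀ {P} → IsTile P → Corner P p → p ≡ bCorner (parity P) P

  localSource-isolated : ∀ {p} → LocalSource p → Isolated p
  localSource-isolated {p} src = EqClosure-isolated avoids
    where
    avoids : ∀ {u v} → CEdge ds u v → u ≢ p × v ≢ p
    avoids {u} {v} e with atTile (λ b P → CEdgeOf b P u v) e
    ... | P , tP , e′ with cEdge-inner e′
    ...   | (cu , u≢a , _) , (cv , v≢a , _) =
      (λ { refl → u≢a (src tP cu) }) , (λ { refl → v≢a (src tP cv) })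

  localSink-isolated : ∀ {p} → LocalSink p → Isolated p
  localSink-isolated {p} snk = EqClosure-isolated avoids
    where
    avoids : ∀ {u v} → CEdge ds u v → u ≢ p × v ≢ p
    avoids {u} {v} e with atTile (λ b P → CEdgeOf b P u v) e
    ... | P , tP , e′ with cEdge-inner e′
    ...   | (cu , _ , u≢b) , (cv , _ , v≢b) =
      (λ { refl → u≢b (snk tP cu) }) , (λ { refl → v≢b (snk tP cv) })

  isSource⇒localSource : ∀ {p} → IsSource ds p → LocalSource p
  isSource⇒localSource {p} (_ , noArrowIn) {P} tP c with corner-isA-or-entered (parity P) c
  ... | inj₁ p≡a = p≡a
  ... | inj₂ (u , v , arr , v≡p⊎c) =
    ⊥-elim (noArrowIn u v (atIndex (λ b Q → TileArrow b Q u v) tP arr) (v∼p v≡p⊎c))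
    where
    v∼p : ∀ {v} → v ≡ p ⊎ CEdgeOf (parity P) P v p → v ∼⟨ ds ⟩ p
    v∼p (inj₁ refl) = ε
    v∼p (inj₂ e)    = fwd (atIndex (λ b Q → CEdgeOf b Q _ p) tP e) ◅ ε

  isSink⇒localSink : ∀ {p} → IsSink ds p → LocalSink p
  isSink⇒localSink {p} (_ , noArrowOut) {P} tP c with corner-isB-or-exited (parity P) c
  ... | inj₁ p≡b = p≡b
  ... | inj₂ (u , v , arr , u≡p⊎c) =
    ⊥-elim (noArrowOut u v (atIndex (λ b Q → TileArrow b Q u v) tP arr) (u∼p u≡p⊎c))
    where
    u∼p : ∀ {u} → u ≡ p ⊎ CEdgeOf (parity P) P p u → u ∼⟨ ds ⟩ p
    u∼p (inj₁ refl) = ε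
    u∼p (inj₂ e)    = bwd (atIndex (λ b Q → CEdgeOf b Q p _) tP e) ◅ ε

  localSource⇒isSource : ∀ {p} → IsVertex ds p → LocalSource p → IsSource ds p
  localSource⇒isSource {p} vertex src = vertex , noArrowIn
    where
    noArrowIn : ∀ u v → Arrow ds u v → ¬ v ∼⟨ ds ⟩ p
    noArrowIn u v arr v∼p
      with atTile (λ b P → TileArrow b P u v) arr | localSource-isolated src (symmetric _ v∼p)
    ... | P , tP , arr′ | refl = let (cv , v≢a) = arrow-head arr′ in v≢a (src tP cv)

  localSink⇒isSink : ∀ {p} → IsVertex ds p → LocalSink p → IsSink ds p
  localSink⇒isSink {p} vertex snk = vertex , noArrowOut
    where
    noArrowOut : ∀ u v → Arrow ds u v → ¬ u ∼⟨ ds ⟩ p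
    noArrowOut u v arr u∼p
      with atTile (λ b P → TileArrow b P u v) arr | localSink-isolated snk (symmetric _ u∼p)
    ... | P , tP , arr′ | refl = let (cu , u≢b) = arrow-tail arr′ in u≢b (snk tP cu)

  origin-localSource : LocalSource (0 , 0)
  origin-localSource tQ sw = refl

  Rising : Point → Set
  Rising P = IsTile P × parity P ≡ true × IsTile (shift N P)

  rising-localSource : ∀ {P} → Rising P → LocalSource (shift N (shift N P))
  rising-localSource {x , y}     (tP , even , tN) tQ sw =
    sym (cong (λ b → aCorner b _) (trans (parity-shift² N N (x , y)) even))
  rising-localSource {x , y}     (tP , even , tN) tQ nw =
    sym (cong (λ b → aCorner b _) (trans (parity-shift N (x , y)) (cong not even)))
  rising-localSource {suc x , y} (tP , even , tN) tQ se =
    ⊥-elim (north≢east _ (shift-injective N (tile-unique tQ tN (+-suc x (suc y)))))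
  rising-localSource {suc x , y} (tP , even , tN) tQ ne =
    ⊥-elim (north≢east _ (tile-unique tQ tP (+-suc x y)))

  eastOfEven-localSink : ∀ {P} → IsTile P → parity P ≡ true → ¬ IsTile (shift E P) →
                         LocalSink (shift E P)
  eastOfEven-localSink {x , y}     tP even ¬tE tQ sw = ⊥-elim (¬tE tQ)
  eastOfEven-localSink {x , y}     tP even ¬tE tQ se = sym (cong (λ b → bCorner b _) even)
  eastOfEven-localSink {x , suc y} tP even ¬tE tQ nw =
    ⊥-elim (north≢east _ (sym (tile-unique tQ tP (sym (+-suc x y)))))
  eastOfEven-localSink {x , suc y} tP even ¬tE tQ ne =
    sym (cong (λ b → bCorner b _) (parity-pred N (x , y) even))

  rising-localSink : ∀ {P} → Rising P → LocalSink (shift E P)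
  rising-localSink {P} (tP , even , tN) = eastOfEven-localSink tP even λ tE →
    north≢east P (tile-unique tN tE (trans (sumPt-shift N P) (sym (sumPt-shift E P))))

  northeastOfLast-localSink : ∀ {P} → sumPt P ≡ L → parity P ≡ false → LocalSink (shift N (shift E P))
  northeastOfLast-localSink {x , y} sP odd tQ sw =
    ⊥-elim (shift-beyond-last {N} {suc x , y} (m≤n⇒m≤1+n (≤-reflexive (sym sP))) tQ)
  northeastOfLast-localSink {x , y} sP odd tQ se =
    ⊥-elim (shift-beyond-last {N} {x , y} (≤-reflexive (sym sP)) tQ)
  northeastOfLast-localSink {x , y} sP odd tQ nw =
    ⊥-elim (shift-beyond-last {E} {x , y} (≤-reflexive (sym sP)) tQ)
  northeastOfLast-localSink {x , y} sP odd tQ ne = sym (cong (λ b → bCorner b _) odd)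

  lastSink-localSink : LocalSink lastSink
  lastSink-localSink with parity last in eq
  ... | true  =
    eastOfEven-localSink last-isTile eq (shift-beyond-last {E} {last} (≤-reflexive (sym sumPt-last)))
  ... | false = northeastOfLast-localSink sumPt-last eq

  aboveOdd-rising : ∀ {Q} → IsTile Q → parity Q ≡ false → LocalSource (shift N Q) →
                    ∃ λ P → Rising P × shift N Q ≡ shift N (shift N P)
  aboveOdd-rising tQ odd src with predecessor tQ (odd≢origin odd)
  ... | N , P , tP , refl = P , (tP , parity-pred N P odd , tQ) , refl
  ... | E , P , tP , refl =
    ⊥-elim (northeast≢ P (trans (src tP ne) (cong (λ b → aCorner b P) {y = true} (parity-pred E P odd))))

  localSource-rising : ∀ {p} → LocalSource p → p ≢ (0 , 0) → ∀ {Q} → IsTile Q → Corner Q p →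
                       ∃ λ P → Rising P × p ≡ shift N (shift N P)
  localSource-rising src p≢0 {Q} tQ c with parity Q in eq | src tQ c
  ... | false | refl = aboveOdd-rising tQ eq src
  ... | true  | refl with predecessor tQ p≢0
  ...   | N , P , tP , refl = aboveOdd-rising tP (parity-pred N P eq) src
  ...   | E , P , tP , refl =
    ⊥-elim (north≢east P (sym (trans (src tP se) (cong (λ b → aCorner b P) {y = false} (parity-pred E P eq)))))

  ≢lastSink⇒≢last : ∀ {Q b} → parity Q ≡ b → bCorner b Q ≢ lastSink → Q ≢ last
  ≢lastSink⇒≢last refl q≢ refl = q≢ refl

  eastOfEven-rising : ∀ {Q} → IsTile Q → parity Q ≡ true → LocalSink (shift E Q) → shift E Q ≢ lastSink →
                      ∃ λ P → Rising P × shift E Q ≡ shift E P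
  eastOfEven-rising {Q} tQ even snk q≢ with successor tQ (≢lastSink⇒≢last even q≢)
  ... | N , tN = Q , (tQ , even , tN) , refl
  ... | E , tE =
    ⊥-elim (northeast≢ (shift E Q) (sym (trans (snk tE sw) (cong (λ b → bCorner b (shift E Q)) odd))))
    where
    odd : parity (shift E Q) ≡ false
    odd = trans (parity-shift E Q) (cong not even)

  localSink-rising : ∀ {q} → LocalSink q → q ≢ lastSink → ∀ {Q} → IsTile Q → Corner Q q →
                     ∃ λ P → Rising P × q ≡ shift E P
  localSink-rising snk q≢ {Q} tQ c with parity Q in eq | snk tQ c
  ... | true  | refl = eastOfEven-rising tQ eq snk q≢
  ... | false | refl with successor tQ (≢lastSink⇒≢last eq q≢)
  ...   | N , tN = eastOfEven-rising tN (trans (parity-shift N Q) (cong not eq)) snk q≢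
  ...   | E , tE =
    ⊥-elim (north≢east (shift E Q) (trans (snk tE nw) (cong (λ b → bCorner b (shift E Q)) even)))
    where
    even : parity (shift E Q) ≡ true
    even = trans (parity-shift E Q) (cong not eq)

  tiles : List Point
  tiles = map (pos ds) (allFin (NumTiles ds))

  tiles-unique : Unique tiles
  tiles-unique = Unique.map⁺ pos-injective (Unique.allFin⁺ (NumTiles ds))

  ∈-tiles⁺ : ∀ {P} → IsTile P → P ∈ tiles
  ∈-tiles⁺ tP with tileIndex tP
  ... | J , refl = ∈-map⁺ (pos ds) (∈-allFin J)

  ∈-tiles⁻ : ∀ {P} → P ∈ tiles → IsTile P
  ∈-tiles⁻ P∈ with ∈-map⁻ (pos ds) {xs = allFin (NumTiles ds)} P∈
  ... | J , _ , refl = pos-isTile J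

  isTile? : ∀ P → Dec (IsTile P)
  isTile? P = map′ ∈-tiles⁻ ∈-tiles⁺ (Any.any? (P ≟P_) tiles)

  rising? : ∀ P → Dec (Rising P)
  rising? P = isTile? P ×-dec (parity P ≟ᵇ true) ×-dec isTile? (shift N P)

  risingTiles : List Point
  risingTiles = filter rising? tiles

  risingTiles-rising : All Rising risingTiles
  risingTiles-rising = all-filter rising? tiles

  ∈-risingTiles : ∀ {P} → Rising P → P ∈ risingTiles
  ∈-risingTiles r = ∈-filter⁺ rising? (∈-tiles⁺ (proj₁ r)) r

  risingTiles-unique : Unique risingTiles
  risingTiles-unique = Unique.filter⁺ rising? tiles-unique

  sources : List Point
  sources = (0 , 0) ∷ map (shift N ∘ shift N) risingTiles

  sinks : List Point
  sinks = lastSink ∷ map (shift E) risingTiles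

  sinks-length : length sinks ≡ length sources
  sinks-length =
    cong suc (trans (length-map (shift E) risingTiles) (sym (length-map (shift N ∘ shift N) risingTiles)))

  sources-areSources : All (IsSource ds) sources
  sources-areSources =
    localSource⇒isSource (atIndex (λ _ Q → Corner Q (0 , 0)) (0 , z≤n , refl) sw) origin-localSource
    ∷ All-map⁺ (All.map aboveRising-isSource risingTiles-rising)
    where
    aboveRising-isSource : ∀ {P} → Rising P → IsSource ds (shift N (shift N P))
    aboveRising-isSource r@(_ , _ , tN) =
      localSource⇒isSource (atIndex (λ _ Q → Corner Q _) tN nw) (rising-localSource r)

  sinks-areSinks : All (IsSink ds) sinks
  sinks-areSinks =
    localSink⇒isSink (atIndex (λ _ Q → Corner Q lastSink) last-isTile (bCorner-corner _ last))
                     lastSink-localSink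
    ∷ All-map⁺ (All.map eastOfRising-isSink risingTiles-rising)
    where
    eastOfRising-isSink : ∀ {P} → Rising P → IsSink ds (shift E P)
    eastOfRising-isSink r@(tP , _ , _) =
      localSink⇒isSink (atIndex (λ _ Q → Corner Q _) tP se) (rising-localSink r)

  lastSink≢eastOfRising : ∀ {P} → Rising P → lastSink ≢ shift E P
  lastSink≢eastOfRising {P} (_ , _ , tN) eq =
    <⇒≱ (subst₂ _<_ sumPt-last sameSum (sumPt-bCorner (parity last) last)) (tile-sum≤ tN)
    where
    sameSum : sumPt lastSink ≡ sumPt (shift N P)
    sameSum = trans (cong sumPt eq) (trans (sumPt-shift E P) (sym (sumPt-shift N P)))

  sources-unique : Unique sources
  sources-unique =
    All-map⁺ (All.universal (λ _ ()) risingTiles)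
    ∷ Unique.map⁺ (shift-injective N ∘ shift-injective N) risingTiles-unique

  sinks-unique : Unique sinks
  sinks-unique =
    All-map⁺ (All.map lastSink≢eastOfRising risingTiles-rising)
    ∷ Unique.map⁺ (shift-injective E) risingTiles-unique

  sources-complete : ∀ {p} → IsSource ds p → p ∈ sources
  sources-complete {p} s with p ≟P (0 , 0) | atTile (λ _ Q → Corner Q p) (proj₁ s)
  ... | yes refl | _          = here refl
  ... | no p≢0   | Q , tQ , c with localSource-rising (isSource⇒localSource s) p≢0 tQ c
  ...   | P , r , refl = there (∈-map⁺ (shift N ∘ shift N) (∈-risingTiles r))

  sinks-complete : ∀ {q} → IsSink ds q → q ∈ sinks
  sinks-complete {q} s with q ≟P lastSink | atTile (λ _ Q → Corner Q q) (proj₁ s)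
  ... | yes refl | _          = here refl
  ... | no q≢    | Q , tQ , c with localSink-rising (isSink⇒localSink s) q≢ tQ c
  ...   | P , r , refl = there (∈-map⁺ (shift E) (∈-risingTiles r))

lemma3p9 : (ds : Snake) → ∃[ n ] (NumClasses ds (IsSource ds) n × NumClasses ds (IsSink ds) n)
lemma3p9 ds =
  length (sources ds)
  , numClasses ds (localSource-isolated ds ∘ isSource⇒localSource ds)
                  (sources-areSources ds) (sources-unique ds) (sources-complete ds)
  , subst (NumClasses ds (IsSink ds)) (sinks-length ds)
          (numClasses ds (localSink-isolated ds ∘ isSink⇒localSink ds)
                         (sinks-areSinks ds) (sinks-unique ds) (sinks-complete ds))
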